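{- Let $L$ be a residuated lattice with $\mathrm{Rad}(L)=\{1\}$, and let $M_0(L)$ be the set of maximal filters of $L$ that are isolated points of $Max(L)$. Then $M_0(L)$ is a dense subset of $Max(L)$ if and only if $\mathrm{Soc}(L)$ is an essential filter of $L$.
   Context: A residuated lattice is an algebra $(L,\wedge,\vee,\odot,\rightarrow,0,1)$ such that $(L,\wedge,\vee,0,1)$ is a bounded lattice, $(L,\odot,1)$ is a commutative monoid, and $x\odot z\le y$ iff $z\le x\rightarrow y$. A filter is a nonempty subset closed under $\odot$ and upward closed. $Max(L)$ is the set of maximal filters, with topology whose open sets are $\{M\in Max(L)\mid A\not\subseteq M\}$ for $A\subseteq L$; $\mathrm{Rad}(L)=\bigcap Max(L)$. A filter $T$ is simple if $T\neq\{1\}$ and the only filters contained in $T$ are $\{1\}$ and $T$; $\mathrm{Soc}(L)$ is the smallest filter containing all simple filters if there is at least one, and $\{1\}$ otherwise. A filter $H$ is essential in $L$ if for every filter $G$, $H\cap G=\{1\}$ implies $G=\{1\}$. -}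

module Defs where

open import Level using (Level; suc; _⊔_)
open import Data.Product using (Σ; ∃; _×_; _,_)
open import Data.Sum using (_⊎_)
open import Relation.Nullary using (¬_)
open import Relation.Binary.PropositionalEquality using (_≡_)
open import Function.Bundles using (_⇔_)

record ResiduatedLattice (a : Level) : Set (suc a) where
  infixr 7 _∧_
  infixr 6 _∨_
  infixr 8 _⊙_
  infixr 5 _⇒_
  infix 4 _≤_
  field
    Carrier : Set a
    _∧_ _∨_ _⊙_ _⇒_ : Carrier → Carrier → Carrier
    𝟘 𝟙 : Carrier
    ∧-comm  : ∀ x y → x ∧ y ≡ y ∧ x
    ∨-comm  : ∀ x y → x ∨ y ≡ y ∨ x
    ∧-assoc : ∀ x y z → (x ∧ y) ∧ z ≡ x ∧ (y ∧ z)
    ∨-assoc : ∀ x y z → (x ∨ y) ∨ z ≡ x ∨ (y ∨ z)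
    ∧-absorbs-∨ : ∀ x y → x ∧ (x ∨ y) ≡ x
    ∨-absorbs-∧ : ∀ x y → x ∨ (x ∧ y) ≡ x
    𝟘-bottom : ∀ x → 𝟘 ∧ x ≡ 𝟘
    𝟙-top    : ∀ x → x ∧ 𝟙 ≡ x
    ⊙-comm  : ∀ x y → x ⊙ y ≡ y ⊙ x
    ⊙-assoc : ∀ x y z → (x ⊙ y) ⊙ z ≡ x ⊙ (y ⊙ z)
    ⊙-identityʳ : ∀ x → x ⊙ 𝟙 ≡ x

  _≤_ : Carrier → Carrier → Set a
  x ≤ y = x ∧ y ≡ x

  field
    residuated : ∀ x y z → (x ⊙ z ≤ y) ⇔ (z ≤ x ⇒ y)

module _ {a : Level} (L : ResiduatedLattice a) where
  open ResiduatedLattice L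

  Subset : Set (suc a)
  Subset = Carrier → Set a

  _⊆_ : ∀ {ℓ₁ ℓ₂} → (Carrier → Set ℓ₁) → (Carrier → Set ℓ₂) → Set (a ⊔ ℓ₁ ⊔ ℓ₂)
  A ⊆ B = ∀ x → A x → B x

  _≐_ : ∀ {ℓ₁ ℓ₂} → (Carrier → Set ℓ₁) → (Carrier → Set ℓ₂) → Set (a ⊔ ℓ₁ ⊔ ℓ₂)
  A ≐ B = (A ⊆ B) × (B ⊆ A)

  -- "F = {1}" (as a subset: every element of F equals 1; filters contain 1)
  IsTrivial : ∀ {ℓ} → (Carrier → Set ℓ) → Set (a ⊔ ℓ)
  IsTrivial F = ∀ x → F x → x ≡ 𝟙

  record IsFilter {ℓ} (F : Carrier → Set ℓ) : Set (a ⊔ ℓ) where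
    field
      nonempty : ∃ λ x → F x
      ⊙-closed : ∀ x y → F x → F y → F (x ⊙ y)
      up-closed : ∀ x y → F x → x ≤ y → F y

  IsProper : Subset → Set a
  IsProper F = ¬ (∀ x → F x)

  record IsMaximal (M : Subset) : Set (suc a) where
    field
      filter : IsFilter M
      proper : IsProper M
      maximal : ∀ (G : Subset) → IsFilter G → IsProper G → M ⊆ G → G ⊆ M

  Rad : Carrier → Set (suc a)
  Rad x = ∀ (M : Subset) → IsMaximal M → M x

  record IsSimple (T : Subset) : Set (suc a) where
    field
      filter : IsFilter T
      nontrivial : ¬ IsTrivial T
      only : ∀ (G : Subset) → IsFilter G → G ⊆ T → IsTrivial G ⊎ (G ≐ T)

  -- Soc(L): the smallest filter containing all simple filters, i.e. the
  -- intersection of all filters containing every simple filter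
  -- (this is {1} when there is no simple filter).
  Soc : Carrier → Set (suc a)
  Soc x = ∀ (F : Subset) → IsFilter F → (∀ (T : Subset) → IsSimple T → T ⊆ F) → F x

  IsEssential : ∀ {ℓ} → (Carrier → Set ℓ) → Set (suc a ⊔ ℓ)
  IsEssential H = ∀ (G : Subset) → IsFilter G → IsTrivial (λ x → H x × G x) → IsTrivial G

  -- Topology on Max(L): open sets U(A) = {M ∈ Max(L) | A ⊈ M}, A ⊆ L.
  -- A point M of Max(L) is isolated iff {M} is open.
  IsIsolated : Subset → Set (suc a)
  IsIsolated M = ∃ λ (A : Subset) →
    ∀ (N : Subset) → IsMaximal N → ((¬ (A ⊆ N)) ⇔ (N ≐ M))

  InM₀ : Subset → Set (suc a)
  InM₀ M = IsMaximal M × IsIsolated M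

  -- A set S of maximal filters is dense in Max(L) iff every closed set
  -- V(A) = Max(L) ∖ U(A) = {M | A ⊆ M} containing S is all of Max(L).
  IsDense : (Subset → Set (suc a)) → Set (suc a)
  IsDense S = ∀ (A : Subset) →
    (∀ (M : Subset) → IsMaximal M → S M → A ⊆ M) →
    ∀ (M : Subset) → IsMaximal M → A ⊆ M

{-# OPTIONS --safe #-}
-- Everything rests on (t ∨ m) ⊙ (t ∨ h)ⁿ ≤ t ∨ (m ⊙ hⁿ). If h lies outside a maximal
-- filter M, maximality gives m ∈ M and n with m ⊙ hⁿ ≤ 0, so every filter containing
-- t ∨ m and t ∨ h contains t. Hence g ∨ u = 1 and u ∉ M force g ∈ M, and the
-- co-annihilator Mᗮ = {z | z ∨ m = 1 for all m ∈ M} is simple as soon as it is nontrivial.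
--
-- When Rad(L) = {1}, a filter G meets Soc(L) only in 1 iff G lies in every isolated
-- maximal filter. If M is isolated, cut out by A, any u ∈ A ∖ M has u ∨ m in every maximal
-- filter, so u ∈ Mᗮ; then Mᗮ is simple and, for g ∈ G, g ∨ u ∈ Soc(L) ∩ G gives g ∨ u = 1,
-- so g ∈ M. Conversely a simple T ⊈ Rad(L) escapes some maximal M, which is then isolated
-- (cut out by T) and meets T only in 1; so T ∩ G = {1}, T ⊆ Gᗮ, and Soc(L) ⊆ Gᗮ.
-- Density of M₀(L) puts every filter contained in all isolated points inside Rad(L) = {1},
-- which by the characterisation is essentiality of Soc(L); for the converse, apply
-- essentiality to principal filters.
module Submission where

open import Defs
open import Level using (Level; suc; lift; lower)
open import Axiom.ExcludedMiddle using (ExcludedMiddle)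
open import Axiom.DoubleNegationElimination using (DoubleNegationElimination; em⇒dne)
open import Function.Base using (id)
open import Function.Bundles using (_⇔_; mk⇔; Equivalence)
open import Data.Product using (∃; ∃₂; _×_; _,_; proj₁; proj₂)
open import Data.Sum using (_⊎_; inj₁; inj₂)
open import Data.Nat using (ℕ; zero; _+_) renaming (suc to 1+)
open import Relation.Nullary using (¬_; yes; no; contradiction)
open import Relation.Nullary.Decidable using (map′)
open import Relation.Unary using (Pred; _∩_; _⊆′_; _⊈′_; _≐′_)
open import Relation.Binary.Bundles using (Poset)
open import Relation.Binary.Definitions using (Reflexive; Transitive; Antisymmetric)
open import Relation.Binary.PropositionalEquality
  using (_≡_; refl; sym; trans; cong; cong₂; subst; isEquivalence)
open import Algebra.Bundles using (CommutativeMonoid)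
open import Algebra.Lattice.Bundles using (Lattice)
import Algebra.Lattice.Properties.Lattice as LatticeProperties
import Algebra.Properties.CommutativeSemigroup as CommutativeSemigroupProperties
import Algebra.Properties.Monoid.Mult as MonoidMult
import Algebra.Structures.Biased as Biased
import Relation.Binary.Lattice as OrderLattice
import Relation.Binary.Reasoning.PartialOrder as ≤-Reasoning

module ResiduatedLatticeProperties {a : Level} (L : ResiduatedLattice a) where
  open ResiduatedLattice L
  open Equivalence

  lattice : Lattice a a
  lattice = record
    { isLattice = record
      { isEquivalence = isEquivalence
      ; ∨-comm        = ∨-comm
      ; ∨-assoc       = ∨-assoc
      ; ∨-cong        = cong₂ _∨_
      ; ∧-comm        = ∧-comm
      ; ∧-assoc       = ∧-assoc
      ; ∧-cong        = cong₂ _∧_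
      ; absorptive    = ∨-absorbs-∧ , ∧-absorbs-∨
      }
    }

  open LatticeProperties lattice public using (∨-idem)

  -- The library orders a lattice by x ≡ x ∧ y, Defs by x ∧ y ≡ x.
  private module ∧-Order = Poset (LatticeProperties.poset lattice)

  ≤-refl : Reflexive _≤_
  ≤-refl = sym ∧-Order.refl

  ≤-reflexive : ∀ {x y} → x ≡ y → x ≤ y
  ≤-reflexive refl = ≤-refl

  ≤-trans : Transitive _≤_
  ≤-trans x≤y y≤z = sym (∧-Order.trans (sym x≤y) (sym y≤z))

  ≤-antisym : Antisymmetric _≡_ _≤_
  ≤-antisym x≤y y≤x = ∧-Order.antisym (sym x≤y) (sym y≤x)

  ≤-poset : Poset a a a
  ≤-poset = record
    { _≤_ = _≤_
    ; isPartialOrder = record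
      { isPreorder = record
        { isEquivalence = isEquivalence
        ; reflexive     = ≤-reflexive
        ; trans         = ≤-trans
        }
      ; antisym = ≤-antisym
      }
    }

  open OrderLattice.IsLattice (LatticeProperties.∨-∧-isOrderTheoreticLattice lattice)
    using (supremum)

  x≤x∨y : ∀ x y → x ≤ x ∨ y
  x≤x∨y = ∧-absorbs-∨

  y≤x∨y : ∀ x y → y ≤ x ∨ y
  y≤x∨y x y = sym (proj₁ (proj₂ (supremum x y)))

  ∨-least : ∀ {x y z} → x ≤ z → y ≤ z → x ∨ y ≤ z
  ∨-least {x} {y} {z} x≤z y≤z = sym (proj₂ (proj₂ (supremum x y)) z (sym x≤z) (sym y≤z))

  𝟙≤x⇒x≡𝟙 : ∀ {x} → 𝟙 ≤ x → x ≡ 𝟙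
  𝟙≤x⇒x≡𝟙 {x} = ≤-antisym (𝟙-top x)

  ⊙-commutativeMonoid : CommutativeMonoid a a
  ⊙-commutativeMonoid = record
    { isCommutativeMonoid = Biased.isCommutativeMonoidʳ record
      { isSemigroup = record
        { isMagma = record { isEquivalence = isEquivalence ; ∙-cong = cong₂ _⊙_ }
        ; assoc   = ⊙-assoc
        }
      ; identityʳ = ⊙-identityʳ
      ; comm      = ⊙-comm
      }
    }

  open CommutativeSemigroupProperties (CommutativeMonoid.commutativeSemigroup ⊙-commutativeMonoid)
    public using (interchange; x∙yz≈y∙xz)
  open MonoidMult (CommutativeMonoid.monoid ⊙-commutativeMonoid) public
    using (×-homo-+) renaming (_×_ to _×ⁿ_)

  infixr 9 _^_
  _^_ : Carrier → ℕ → Carrier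
  x ^ n = n ×ⁿ x

  open ≤-Reasoning ≤-poset

  ⊙-monoʳ-≤ : ∀ x {y z} → y ≤ z → x ⊙ y ≤ x ⊙ z
  ⊙-monoʳ-≤ x {y} {z} y≤z =
    from (residuated x _ y) (≤-trans y≤z (to (residuated x _ z) ≤-refl))

  ⊙-mono-≤ : ∀ {x x′ y y′} → x ≤ x′ → y ≤ y′ → x ⊙ y ≤ x′ ⊙ y′
  ⊙-mono-≤ {x} {x′} {y} {y′} x≤x′ y≤y′ = begin
    x ⊙ y    ≤⟨ ⊙-monoʳ-≤ x y≤y′ ⟩
    x ⊙ y′   ≡⟨ ⊙-comm x y′ ⟩
    y′ ⊙ x   ≤⟨ ⊙-monoʳ-≤ y′ x≤x′ ⟩
    y′ ⊙ x′  ≡⟨ ⊙-comm y′ x′ ⟩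
    x′ ⊙ y′  ∎

  x⊙y≤x : ∀ x y → x ⊙ y ≤ x
  x⊙y≤x x y = begin
    x ⊙ y  ≤⟨ ⊙-monoʳ-≤ x (𝟙-top y) ⟩
    x ⊙ 𝟙  ≡⟨ ⊙-identityʳ x ⟩
    x      ∎

  x⊙y≤y : ∀ x y → x ⊙ y ≤ y
  x⊙y≤y x y = subst (_≤ y) (⊙-comm y x) (x⊙y≤x y x)

  ⊙-∨-least : ∀ {x y z w} → x ⊙ y ≤ w → x ⊙ z ≤ w → x ⊙ (y ∨ z) ≤ w
  ⊙-∨-least {x} {y} {z} {w} x⊙y≤w x⊙z≤w = from (residuated x w (y ∨ z))
    (∨-least (to (residuated x w y) x⊙y≤w) (to (residuated x w z) x⊙z≤w))

  [x∨y]⊙[x∨z]≤x∨y⊙z : ∀ x y z → (x ∨ y) ⊙ (x ∨ z) ≤ x ∨ y ⊙ z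
  [x∨y]⊙[x∨z]≤x∨y⊙z x y z = ⊙-∨-least [x∨y]⊙x≤ (subst (_≤ x ∨ y ⊙ z) (⊙-comm z (x ∨ y)) z⊙[x∨y]≤)
    where
    [x∨y]⊙x≤ : (x ∨ y) ⊙ x ≤ x ∨ y ⊙ z
    [x∨y]⊙x≤ = ≤-trans (x⊙y≤y (x ∨ y) x) (x≤x∨y x _)
    z⊙[x∨y]≤ : z ⊙ (x ∨ y) ≤ x ∨ y ⊙ z
    z⊙[x∨y]≤ = ⊙-∨-least (≤-trans (x⊙y≤y z x) (x≤x∨y x _))
                         (subst (_≤ x ∨ y ⊙ z) (⊙-comm y z) (y≤x∨y x _))

  [x∨y]⊙[x∨z]^n≤x∨y⊙z^n : ∀ x y z n → (x ∨ y) ⊙ (x ∨ z) ^ n ≤ x ∨ y ⊙ z ^ n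
  [x∨y]⊙[x∨z]^n≤x∨y⊙z^n x y z zero = begin
    (x ∨ y) ⊙ 𝟙  ≡⟨ ⊙-identityʳ (x ∨ y) ⟩
    x ∨ y        ≡⟨ cong (x ∨_) (sym (⊙-identityʳ y)) ⟩
    x ∨ y ⊙ 𝟙    ∎
  [x∨y]⊙[x∨z]^n≤x∨y⊙z^n x y z (1+ n) = begin
    (x ∨ y) ⊙ (x ∨ z) ⊙ (x ∨ z) ^ n  ≡⟨ x∙yz≈y∙xz (x ∨ y) (x ∨ z) _ ⟩
    (x ∨ z) ⊙ (x ∨ y) ⊙ (x ∨ z) ^ n  ≤⟨ ⊙-monoʳ-≤ (x ∨ z) ([x∨y]⊙[x∨z]^n≤x∨y⊙z^n x y z n) ⟩
    (x ∨ z) ⊙ (x ∨ y ⊙ z ^ n)        ≤⟨ [x∨y]⊙[x∨z]≤x∨y⊙z x z (y ⊙ z ^ n) ⟩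
    x ∨ z ⊙ y ⊙ z ^ n                ≡⟨ cong (x ∨_) (x∙yz≈y∙xz z y _) ⟩
    x ∨ y ⊙ z ⊙ z ^ n                ∎

  ⊙^≤𝟘⇒[x∨y]⊙[x∨z]^n≤x : ∀ x {y z} n → y ⊙ z ^ n ≤ 𝟘 → (x ∨ y) ⊙ (x ∨ z) ^ n ≤ x
  ⊙^≤𝟘⇒[x∨y]⊙[x∨z]^n≤x x {y} {z} n y⊙zⁿ≤𝟘 = begin
    (x ∨ y) ⊙ (x ∨ z) ^ n  ≤⟨ [x∨y]⊙[x∨z]^n≤x∨y⊙z^n x y z n ⟩
    x ∨ y ⊙ z ^ n          ≤⟨ ∨-least ≤-refl (≤-trans y⊙zⁿ≤𝟘 (𝟘-bottom x)) ⟩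
    x                      ∎

module Filters {a : Level} (L : ResiduatedLattice a) where
  open ResiduatedLattice L
  open ResiduatedLatticeProperties L

  module _ {ℓ} {F : Pred Carrier ℓ} (F-isFilter : IsFilter L F) where
    open IsFilter F-isFilter

    ∈-mono : ∀ {x y} → F x → x ≤ y → F y
    ∈-mono = up-closed _ _

    𝟙∈ : F 𝟙
    𝟙∈ = ∈-mono (proj₂ nonempty) (𝟙-top _)

    ^∈ : ∀ {x} → F x → ∀ n → F (x ^ n)
    ^∈ x∈F zero   = 𝟙∈
    ^∈ x∈F (1+ n) = ⊙-closed _ _ x∈F (^∈ x∈F n)

    ∨ˡ∈ : ∀ {x} y → F x → F (x ∨ y)
    ∨ˡ∈ y x∈F = ∈-mono x∈F (x≤x∨y _ y)

    ∨ʳ∈ : ∀ x {y} → F y → F (x ∨ y)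
    ∨ʳ∈ x y∈F = ∈-mono y∈F (y≤x∨y x _)

    ∨-annihilating⇒∈ : ∀ {t m h} n → m ⊙ h ^ n ≤ 𝟘 → F (t ∨ m) → F (t ∨ h) → F t
    ∨-annihilating⇒∈ {t} n m⊙hⁿ≤𝟘 t∨m∈F t∨h∈F =
      ∈-mono (⊙-closed _ _ t∨m∈F (^∈ t∨h∈F n)) (⊙^≤𝟘⇒[x∨y]⊙[x∨z]^n≤x t n m⊙hⁿ≤𝟘)

  open IsFilter

  ∩-isFilter : ∀ {ℓ₁ ℓ₂} {F : Pred Carrier ℓ₁} {G : Pred Carrier ℓ₂} →
               IsFilter L F → IsFilter L G → IsFilter L (F ∩ G)
  ∩-isFilter F-isFilter G-isFilter = record
    { nonempty  = 𝟙 , 𝟙∈ F-isFilter , 𝟙∈ G-isFilter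
    ; ⊙-closed  = λ { x y (x∈F , x∈G) (y∈F , y∈G) →
        ⊙-closed F-isFilter x y x∈F y∈F , ⊙-closed G-isFilter x y x∈G y∈G }
    ; up-closed = λ { x y (x∈F , x∈G) x≤y → ∈-mono F-isFilter x∈F x≤y , ∈-mono G-isFilter x∈G x≤y }
    }

  infix 10 _ᗮ
  _ᗮ : Subset L → Subset L
  (S ᗮ) z = ∀ s → S s → z ∨ s ≡ 𝟙

  ᗮ-isFilter : ∀ S → IsFilter L (S ᗮ)
  ᗮ-isFilter S = record
    { nonempty  = 𝟙 , λ s _ → 𝟙≤x⇒x≡𝟙 (x≤x∨y 𝟙 s)
    ; ⊙-closed  = λ x y x∈Sᗮ y∈Sᗮ s s∈S → x⊙y∨s≡𝟙 (x∈Sᗮ s s∈S) (y∈Sᗮ s s∈S)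
    ; up-closed = λ x y x∈Sᗮ x≤y s s∈S → 𝟙≤x⇒x≡𝟙 (begin
        𝟙      ≡⟨ sym (x∈Sᗮ s s∈S) ⟩
        x ∨ s  ≤⟨ ∨-least (≤-trans x≤y (x≤x∨y y s)) (y≤x∨y y s) ⟩
        y ∨ s  ∎)
    }
    where
    open ≤-Reasoning ≤-poset
    x⊙y∨s≡𝟙 : ∀ {x y s} → x ∨ s ≡ 𝟙 → y ∨ s ≡ 𝟙 → x ⊙ y ∨ s ≡ 𝟙
    x⊙y∨s≡𝟙 {x} {y} {s} x∨s≡𝟙 y∨s≡𝟙 = 𝟙≤x⇒x≡𝟙 (begin
      𝟙                  ≡⟨ sym (⊙-identityʳ 𝟙) ⟩
      𝟙 ⊙ 𝟙              ≡⟨ sym (cong₂ _⊙_ (trans (∨-comm s x) x∨s≡𝟙) (trans (∨-comm s y) y∨s≡𝟙)) ⟩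
      (s ∨ x) ⊙ (s ∨ y)  ≤⟨ [x∨y]⊙[x∨z]≤x∨y⊙z s x y ⟩
      s ∨ x ⊙ y          ≡⟨ ∨-comm s (x ⊙ y) ⟩
      x ⊙ y ∨ s          ∎)

  ∩ᗮ-trivial : ∀ S → IsTrivial L (S ∩ S ᗮ)
  ∩ᗮ-trivial S z (z∈S , z∈Sᗮ) = trans (sym (∨-idem z)) (z∈Sᗮ z z∈S)

  ∩-trivial⇒⊆ᗮ : ∀ {T G : Subset L} → IsFilter L T → IsFilter L G → IsTrivial L (T ∩ G) → T ⊆′ G ᗮ
  ∩-trivial⇒⊆ᗮ T-isFilter G-isFilter T∩G-trivial t t∈T g g∈G =
    T∩G-trivial (t ∨ g) (∨ˡ∈ T-isFilter g t∈T , ∨ʳ∈ G-isFilter t g∈G)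

  ⟨_⟩ : Carrier → Subset L
  ⟨ x ⟩ y = ∃ λ n → x ^ n ≤ y

  ⟨⟩-isFilter : ∀ x → IsFilter L ⟨ x ⟩
  ⟨⟩-isFilter x = record
    { nonempty  = 𝟙 , 0 , ≤-refl
    ; ⊙-closed  = λ { y z (m , xᵐ≤y) (n , xⁿ≤z) →
        m + n , subst (_≤ y ⊙ z) (sym (×-homo-+ x m n)) (⊙-mono-≤ xᵐ≤y xⁿ≤z) }
    ; up-closed = λ { y z (n , xⁿ≤y) y≤z → n , ≤-trans xⁿ≤y y≤z }
    }

  x∈⟨x⟩ : ∀ x → ⟨ x ⟩ x
  x∈⟨x⟩ x = 1 , x⊙y≤x x 𝟙

  ⟨⟩-least : ∀ {ℓ} {F : Pred Carrier ℓ} {x} → IsFilter L F → F x → ⟨ x ⟩ ⊆′ F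
  ⟨⟩-least F-isFilter x∈F y (n , xⁿ≤y) = ∈-mono F-isFilter (^∈ F-isFilter x∈F n) xⁿ≤y

  adjoin : Subset L → Carrier → Subset L
  adjoin M h y = ∃₂ λ m n → M m × m ⊙ h ^ n ≤ y

  adjoin-isFilter : ∀ {M} h → IsFilter L M → IsFilter L (adjoin M h)
  adjoin-isFilter h M-isFilter = record
    { nonempty  = 𝟙 , 𝟙 , 0 , 𝟙∈ M-isFilter , 𝟙-top _
    ; ⊙-closed  = λ { y z (m , k , m∈M , m⊙hᵏ≤y) (m′ , n , m′∈M , m′⊙hⁿ≤z) →
        m ⊙ m′ , k + n , ⊙-closed M-isFilter m m′ m∈M m′∈M ,
        subst (_≤ y ⊙ z) (sym (trans (cong ((m ⊙ m′) ⊙_) (×-homo-+ h k n)) (interchange m m′ _ _)))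
          (⊙-mono-≤ m⊙hᵏ≤y m′⊙hⁿ≤z) }
    ; up-closed = λ { y z (m , n , m∈M , m⊙hⁿ≤y) y≤z → m , n , m∈M , ≤-trans m⊙hⁿ≤y y≤z }
    }

  ⊆adjoin : ∀ M h → M ⊆′ adjoin M h
  ⊆adjoin M h m m∈M = m , 0 , m∈M , ≤-reflexive (⊙-identityʳ m)

  ∈adjoin : ∀ {M} h → IsFilter L M → adjoin M h h
  ∈adjoin h M-isFilter = 𝟙 , 1 , 𝟙∈ M-isFilter , ≤-trans (x⊙y≤y 𝟙 _) (x⊙y≤x h 𝟙)

  simple-∩-trivial : ∀ {T N : Subset L} → IsSimple L T → IsFilter L N → T ⊈′ N → IsTrivial L (T ∩ N)
  simple-∩-trivial {T} {N} T-simple N-isFilter T⊈N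
    with IsSimple.only T-simple (T ∩ N) (∩-isFilter (IsSimple.filter T-simple) N-isFilter)
                       (λ _ → proj₁)
  ... | inj₁ T∩N-trivial   = T∩N-trivial
  ... | inj₂ (_ , T⊆T∩N) = contradiction (λ t t∈T → proj₂ (T⊆T∩N t t∈T)) T⊈N

  simple⊆Soc : ∀ {T} → IsSimple L T → T ⊆′ Soc L
  simple⊆Soc T-simple t t∈T F F-isFilter simples⊆F = simples⊆F _ T-simple t t∈T

module MaximalFilters {a : Level} (em : ExcludedMiddle (suc a)) (L : ResiduatedLattice a) where
  open ResiduatedLattice L
  open ResiduatedLatticeProperties L
  open Filters L
  open IsMaximal using (filter)

  private
    em₀ : ExcludedMiddle a
    em₀ = map′ lower lift em

    dne₀ : DoubleNegationElimination a
    dne₀ = em⇒dne em₀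

  ⊈⇒∃∉ : ∀ {A B : Subset L} → A ⊈′ B → ∃ λ x → A x × ¬ B x
  ⊈⇒∃∉ A⊈B = dne₀ λ ∄x → A⊈B λ x x∈A → dne₀ λ x∉B → ∄x (x , x∈A , x∉B)

  maximal-∉⇒⊙^≤𝟘 : ∀ {M h} → IsMaximal L M → ¬ M h → ∃₂ λ m n → M m × m ⊙ h ^ n ≤ 𝟘
  maximal-∉⇒⊙^≤𝟘 {M} {h} M-maximal h∉M = dne₀ λ 𝟘∉adjoin →
    h∉M (maximal (adjoin M h) (adjoin-isFilter h M-isFilter) (λ all → 𝟘∉adjoin (all 𝟘))
                 (⊆adjoin M h) h (∈adjoin h M-isFilter))
    where open IsMaximal M-maximal using (maximal) renaming (filter to M-isFilter)

  maximal-prime : ∀ {M g u} → IsMaximal L M → g ∨ u ≡ 𝟙 → ¬ M u → M g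
  maximal-prime {M} M-maximal g∨u≡𝟙 u∉M with maximal-∉⇒⊙^≤𝟘 M-maximal u∉M
  ... | m , n , m∈M , m⊙uⁿ≤𝟘 = ∨-annihilating⇒∈ (filter M-maximal) n m⊙uⁿ≤𝟘
    (∨ʳ∈ (filter M-maximal) _ m∈M) (subst M (sym g∨u≡𝟙) (𝟙∈ (filter M-maximal)))

  maximal-ᗮ-simple : ∀ {M} → IsMaximal L M → ¬ IsTrivial L (M ᗮ) → IsSimple L (M ᗮ)
  maximal-ᗮ-simple {M} M-maximal Mᗮ-nontrivial = record
    { filter     = ᗮ-isFilter M
    ; nontrivial = Mᗮ-nontrivial
    ; only       = only
    }
    where
    only : ∀ H → IsFilter L H → H ⊆′ M ᗮ → IsTrivial L H ⊎ (H ≐′ M ᗮ)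
    only H H-isFilter H⊆Mᗮ with em₀ {IsTrivial L H}
    ... | yes H-trivial   = inj₁ H-trivial
    ... | no H-nontrivial with ⊈⇒∃∉ {B = _≡ 𝟙} H-nontrivial
    ... | h , h∈H , h≢𝟙
        with maximal-∉⇒⊙^≤𝟘 M-maximal (λ h∈M → h≢𝟙 (∩ᗮ-trivial M h (h∈M , H⊆Mᗮ h h∈H)))
    ... | m , n , m∈M , m⊙hⁿ≤𝟘 = inj₂ (H⊆Mᗮ , Mᗮ⊆H)
      where
      Mᗮ⊆H : M ᗮ ⊆′ H
      Mᗮ⊆H t t∈Mᗮ = ∨-annihilating⇒∈ H-isFilter n m⊙hⁿ≤𝟘
        (subst H (sym (t∈Mᗮ m m∈M)) (𝟙∈ H-isFilter)) (∨ʳ∈ H-isFilter t h∈H)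

  simple-⊈-maximal⇒⊆ : ∀ {T N N′} → IsSimple L T → IsMaximal L N → IsMaximal L N′ →
                       T ⊈′ N → T ⊈′ N′ → N ⊆′ N′
  simple-⊈-maximal⇒⊆ T-simple N-maximal N′-maximal T⊈N T⊈N′ y y∈N with ⊈⇒∃∉ T⊈N′
  ... | t , t∈T , t∉N′ = maximal-prime N′-maximal y∨t≡𝟙 t∉N′
    where
    y∨t≡𝟙 : y ∨ t ≡ 𝟙
    y∨t≡𝟙 = simple-∩-trivial T-simple (filter N-maximal) T⊈N (y ∨ t)
      (∨ʳ∈ (IsSimple.filter T-simple) y t∈T , ∨ˡ∈ (filter N-maximal) t y∈N)

  simple-⊈⇒isolated : ∀ {T M} → IsSimple L T → IsMaximal L M → T ⊈′ M → IsIsolated L M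
  simple-⊈⇒isolated T-simple M-maximal T⊈M = _ , λ N N-maximal → mk⇔
    (λ T⊈N → simple-⊈-maximal⇒⊆ T-simple N-maximal M-maximal T⊈N T⊈M
           , simple-⊈-maximal⇒⊆ T-simple M-maximal N-maximal T⊈M T⊈N)
    (λ { (N⊆M , _) T⊆N → T⊈M λ t t∈T → N⊆M t (T⊆N t t∈T) })

  ⋂M₀ : Pred Carrier (suc a)
  ⋂M₀ x = ∀ M → InM₀ L M → M x

  module _ (Rad-trivial : IsTrivial L (Rad L)) where

    simple⇒⊈maximal : ∀ {T} → IsSimple L T → ∃ λ M → IsMaximal L M × T ⊈′ M
    simple⇒⊈maximal T-simple with ⊈⇒∃∉ {B = _≡ 𝟙} (IsSimple.nontrivial T-simple)
    ... | t , t∈T , t≢𝟙 = em⇒dne em λ ∄M → t≢𝟙 (Rad-trivial t λ M M-maximal →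
      dne₀ λ t∉M → ∄M (M , M-maximal , λ T⊆M → t∉M (T⊆M t t∈T)))

    isolated⇒∃ᗮ∉ : ∀ {M} → IsMaximal L M → IsIsolated L M → ∃ λ u → (M ᗮ) u × ¬ M u
    isolated⇒∃ᗮ∉ {M} M-maximal (A , A⊈N⇔N≐M)
      with ⊈⇒∃∉ (Equivalence.from (A⊈N⇔N≐M M M-maximal) ((λ _ → id) , (λ _ → id)))
    ... | u , u∈A , u∉M = u , (λ m m∈M → Rad-trivial (u ∨ m) (u∨m∈maximal m∈M)) , u∉M
      where
      u∨m∈maximal : ∀ {m} → M m → ∀ N → IsMaximal L N → N (u ∨ m)
      u∨m∈maximal {m} m∈M N N-maximal with em₀ {A ⊆′ N}
      ... | yes A⊆N = ∨ˡ∈ (filter N-maximal) m (A⊆N u u∈A)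
      ... | no A⊈N  =
        ∨ʳ∈ (filter N-maximal) u (proj₂ (Equivalence.to (A⊈N⇔N≐M N N-maximal) A⊈N) m m∈M)

    Soc-∩-trivial⇒⊆⋂M₀ : ∀ {G : Subset L} → IsFilter L G → IsTrivial L (Soc L ∩ G) → G ⊆′ ⋂M₀
    Soc-∩-trivial⇒⊆⋂M₀ G-isFilter Soc∩G-trivial g g∈G M (M-maximal , M-isolated)
      with isolated⇒∃ᗮ∉ M-maximal M-isolated
    ... | u , u∈Mᗮ , u∉M = maximal-prime M-maximal g∨u≡𝟙 u∉M
      where
      Mᗮ-simple : IsSimple L (M ᗮ)
      Mᗮ-simple = maximal-ᗮ-simple M-maximal λ Mᗮ-trivial →
        u∉M (subst M (sym (Mᗮ-trivial u u∈Mᗮ)) (𝟙∈ (filter M-maximal)))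
      g∨u≡𝟙 : g ∨ u ≡ 𝟙
      g∨u≡𝟙 = Soc∩G-trivial (g ∨ u)
        (simple⊆Soc Mᗮ-simple (g ∨ u) (∨ʳ∈ (ᗮ-isFilter M) g u∈Mᗮ) , ∨ˡ∈ G-isFilter u g∈G)

    ⊆⋂M₀⇒simple-∩-trivial : ∀ {G T : Subset L} → G ⊆′ ⋂M₀ → IsSimple L T → IsTrivial L (T ∩ G)
    ⊆⋂M₀⇒simple-∩-trivial G⊆⋂M₀ T-simple with simple⇒⊈maximal T-simple
    ... | M , M-maximal , T⊈M = λ { x (x∈T , x∈G) →
      simple-∩-trivial T-simple (filter M-maximal) T⊈M x
        (x∈T , G⊆⋂M₀ x x∈G M (M-maximal , simple-⊈⇒isolated T-simple M-maximal T⊈M)) }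

    ⊆⋂M₀⇒Soc-∩-trivial : ∀ {G : Subset L} → IsFilter L G → G ⊆′ ⋂M₀ → IsTrivial L (Soc L ∩ G)
    ⊆⋂M₀⇒Soc-∩-trivial {G} G-isFilter G⊆⋂M₀ x (x∈Soc , x∈G) =
      ∩ᗮ-trivial G x (x∈G , x∈Soc (G ᗮ) (ᗮ-isFilter G) λ T T-simple →
        ∩-trivial⇒⊆ᗮ (IsSimple.filter T-simple) G-isFilter (⊆⋂M₀⇒simple-∩-trivial G⊆⋂M₀ T-simple))

    dense⇒essential : IsDense L (InM₀ L) → IsEssential L (Soc L)
    dense⇒essential M₀-dense G G-isFilter Soc∩G-trivial x x∈G = Rad-trivial x λ M M-maximal →
      M₀-dense G (λ M′ _ M′∈M₀ y y∈G → Soc-∩-trivial⇒⊆⋂M₀ G-isFilter Soc∩G-trivial y y∈G M′ M′∈M₀)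
        M M-maximal x x∈G

    essential⇒dense : IsEssential L (Soc L) → IsDense L (InM₀ L)
    essential⇒dense Soc-essential A A⊆M₀ M M-maximal x x∈A =
      subst M (sym x≡𝟙) (𝟙∈ (filter M-maximal))
      where
      ⟨x⟩⊆⋂M₀ : ⟨ x ⟩ ⊆′ ⋂M₀
      ⟨x⟩⊆⋂M₀ y y∈⟨x⟩ M′ M′∈M₀@(M′-maximal , _) =
        ⟨⟩-least (filter M′-maximal) (A⊆M₀ M′ M′-maximal M′∈M₀ x x∈A) y y∈⟨x⟩
      x≡𝟙 : x ≡ 𝟙
      x≡𝟙 = Soc-essential ⟨ x ⟩ (⟨⟩-isFilter x)
              (⊆⋂M₀⇒Soc-∩-trivial (⟨⟩-isFilter x) ⟨x⟩⊆⋂M₀) x (x∈⟨x⟩ x)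

theorem4p8 : ∀ {a : Level} → ExcludedMiddle (suc a) → (L : ResiduatedLattice a) →
    IsTrivial L (Rad L) →
    (IsDense L (InM₀ L) ⇔ IsEssential L (Soc L))
theorem4p8 em L Rad-trivial = mk⇔ (dense⇒essential Rad-trivial) (essential⇒dense Rad-trivial)
  where open MaximalFilters em L
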